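{- Let $F$ be the Fibonacci sequence with $F(0)=0$, $F(1)=1$, $F(m)=F(m-1)+F(m-2)$. For $n\geq 1$, let $\mathcal{L}_n$ be the set of marked compositions of $n$. Then $|\mathcal{L}_n|=(n-1)F(n-1)$ for all $n\geq 1$. Moreover, for $n\geq 3$, $\mathcal{L}_n$ is the disjoint union of the four sets: $A'_n$ (marked compositions whose last summand is $1$ and is not part of the marked level), $B'_n$ (last summand is $2$ and not part of the marked level), $C'_n$ (the marked level consists of the last two summands, both equal to $1$), and $D'_n$ (the marked level consists of the last two summands, both equal to $2$).
   Context: A composition of $n$ (into ones and twos) is a sequence $(r_1,\dots,r_k)$, $k\geq 1$, with each $r_i\in\{1,2\}$ and $r_1+\cdots+r_k=n$, written $r_1+\cdots+r_k$. A level is an index $j\in[k-1]$ with $r_j=r_{j+1}$ (a pair of equal consecutive summands). A marked composition of $n$ is a composition of $n$ together with a choice of exactly one of its levels. -}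

module Defs where

open import Data.Nat using (ℕ; zero; suc; _+_; _≤_; _<_)
open import Data.List using (List; []; _∷_; length; map)
open import Data.Nat.ListAction using (sum)
open import Data.Empty using (⊥)
open import Data.Maybe using (Maybe; just; nothing)
open import Data.Product using (_×_)
open import Relation.Binary.PropositionalEquality using (_≡_)
open import Relation.Nullary using (¬_)

fib : ℕ → ℕ
fib zero = 0
fib (suc zero) = 1
fib (suc (suc m)) = fib (suc m) + fib m

data Part : Set where
  one two : Part

val : Part → ℕ
val one = 1
val two = 2

-- 1-based entry: entry (r₁ ∷ … ∷ rₖ) i = just rᵢ for 1 ≤ i ≤ k, nothing otherwise
entry : {A : Set} → List A → ℕ → Maybe A
entry [] _ = nothing
entry (x ∷ xs) zero = nothing
entry (x ∷ xs) (suc zero) = just x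
entry (x ∷ xs) (suc (suc i)) = entry xs (suc i)

IsLevel : List Part → ℕ → Set
IsLevel rs j = (1 ≤ j) × (j < length rs) × (entry rs j ≡ entry rs (suc j))

record Marked (n : ℕ) : Set where
  constructor marked
  field
    parts    : List Part
    nonempty : 1 ≤ length parts
    sums     : sum (map val parts) ≡ n
    mark     : ℕ
    isLevel  : IsLevel parts mark
open Marked public

A′ : {n : ℕ} → Marked n → Set
A′ x = (entry (parts x) (length (parts x)) ≡ just one) × ¬ (suc (mark x) ≡ length (parts x))

B′ : {n : ℕ} → Marked n → Set
B′ x = (entry (parts x) (length (parts x)) ≡ just two) × ¬ (suc (mark x) ≡ length (parts x))

C′ : {n : ℕ} → Marked n → Set
C′ x = (suc (mark x) ≡ length (parts x)) × (entry (parts x) (mark x) ≡ just one)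
       × (entry (parts x) (length (parts x)) ≡ just one)

D′ : {n : ℕ} → Marked n → Set
D′ x = (suc (mark x) ≡ length (parts x)) × (entry (parts x) (mark x) ≡ just two)
       × (entry (parts x) (length (parts x)) ≡ just two)

Disjoint : {n : ℕ} → (Marked n → Set) → (Marked n → Set) → Set
Disjoint {n} P Q = (x : Marked n) → P x → Q x → ⊥

-- Classify a marked composition by its first summand: either that summand lies outside the
-- marked level, and removing it leaves a marked composition of n − 1 or n − 2, or the marked
-- level is the first two summands 1+1 or 2+2, followed by an arbitrary composition of n − 2 or
-- n − 4.  Since there are F(m+1) compositions of m, the counts ℓₙ satisfy
-- ℓₙ = ℓₙ₋₁ + ℓₙ₋₂ + F(n−1) + F(n−3), which (n−1)F(n−1) solves.
module Submission where

open import Defs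
open import Data.Nat using (ℕ; zero; suc; _+_; _*_; _∸_; _≤_; _≟_; s≤s; z≤n)
open import Data.Fin using (Fin)
open import Data.Nat.Properties using (suc-injective; ≤-irrelevant; ≡-irrelevant; ≤-trans; <⇒≤)
open import Data.Nat.Solver using (module +-*-Solver)
open import Data.Nat.ListAction using (sum)
open import Data.List using (List; []; _∷_; length; map)
open import Data.List.Properties using (∷-injectiveʳ)
open import Data.Maybe using (Maybe; just)
import Data.Maybe.Properties as Maybe
open import Data.Product using (Σ; ∃; _×_; _,_; proj₁; proj₂)
open import Data.Sum using (_⊎_; inj₁; inj₂)
open import Data.Unit using (tt)
open import Data.Empty using (⊥; ⊥-elim)
open import Data.Fin.Properties using (+↔⊎; 0↔⊥; 1↔⊤)
open import Data.Sum.Function.Propositional using (_⊎-↔_)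
open import Function.Bundles using (_↔_; mk↔ₛ′; mk⤖)
open import Function.Properties.Inverse using (↔-trans; ↔-sym)
open import Function.Properties.Bijection using (⤖⇒↔)
open import Function.Consequences.Propositional using (strictlySurjective⇒surjective)
open import Relation.Nullary using (yes; no)
open import Relation.Binary.Definitions using (DecidableEquality)
open import Relation.Binary.PropositionalEquality
open import Axiom.UniquenessOfIdentityProofs using (UIP; module Decidable⇒UIP)

private
  variable
    A B : Set
    a b m n j : ℕ
    rs : List Part

infixr 4 _⊎-↔-+_

_⊎-↔-+_ : A ↔ Fin a → B ↔ Fin b → (A ⊎ B) ↔ Fin (a + b)
f ⊎-↔-+ g = ↔-trans (f ⊎-↔ g) (↔-sym +↔⊎)

data Composition : ℕ → Set where
  []    : Composition 0
  one∷_ : Composition n → Composition (1 + n)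
  two∷_ : Composition n → Composition (2 + n)

Composition₋₂ : ℕ → Set
Composition₋₂ (suc (suc n)) = Composition n
Composition₋₂ _             = ⊥

-- The marked level is counted from the front: one∷_ and two∷_ prepend a summand that is not in
-- it, one-one∷_ and two-two∷_ mark the first two summands.
data MarkedComposition : ℕ → Set where
  one∷_     : MarkedComposition n → MarkedComposition (1 + n)
  two∷_     : MarkedComposition n → MarkedComposition (2 + n)
  one-one∷_ : Composition n → MarkedComposition (2 + n)
  two-two∷_ : Composition n → MarkedComposition (4 + n)

composition-unfold : Composition (2 + n) ↔ (Composition (1 + n) ⊎ Composition n)
composition-unfold = mk↔ₛ′ to from (λ { (inj₁ _) → refl ; (inj₂ _) → refl })
                                   (λ { (one∷ _) → refl ; (two∷ _) → refl })
  where
  to : Composition (2 + n) → Composition (1 + n) ⊎ Composition n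
  to (one∷ w) = inj₁ w
  to (two∷ w) = inj₂ w
  from : Composition (1 + n) ⊎ Composition n → Composition (2 + n)
  from (inj₁ w) = one∷ w
  from (inj₂ w) = two∷ w

composition↔Fin : ∀ n → Composition n ↔ Fin (fib (suc n))
composition↔Fin 0 = ↔-trans (mk↔ₛ′ (λ _ → tt) (λ _ → []) (λ _ → refl) λ { [] → refl }) (↔-sym 1↔⊤)
composition↔Fin 1 =
  ↔-trans (mk↔ₛ′ (λ _ → tt) (λ _ → one∷ []) (λ _ → refl) λ { (one∷ []) → refl }) (↔-sym 1↔⊤)
composition↔Fin (suc (suc n)) =
  ↔-trans composition-unfold (composition↔Fin (suc n) ⊎-↔-+ composition↔Fin n)

composition₋₂↔Fin : ∀ n → Composition₋₂ n ↔ Fin (fib (n ∸ 1))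
composition₋₂↔Fin 0             = ↔-sym 0↔⊥
composition₋₂↔Fin 1             = ↔-sym 0↔⊥
composition₋₂↔Fin (suc (suc n)) = composition↔Fin n

markedComposition-unfold :
  MarkedComposition (2 + n) ↔
    (MarkedComposition (1 + n) ⊎ (MarkedComposition n ⊎ (Composition n ⊎ Composition₋₂ n)))
markedComposition-unfold = mk↔ₛ′ to from to∘from from∘to
  where
  to : MarkedComposition (2 + m) →
       MarkedComposition (1 + m) ⊎ (MarkedComposition m ⊎ (Composition m ⊎ Composition₋₂ m))
  to (one∷ x)     = inj₁ x
  to (two∷ x)     = inj₂ (inj₁ x)
  to (one-one∷ w) = inj₂ (inj₂ (inj₁ w))
  to (two-two∷ w) = inj₂ (inj₂ (inj₂ w))
  two-two∷₋₂ : ∀ k → Composition₋₂ k → MarkedComposition (2 + k)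
  two-two∷₋₂ (suc (suc k)) w = two-two∷ w
  to∘two-two∷₋₂ : ∀ k (w : Composition₋₂ k) → to (two-two∷₋₂ k w) ≡ inj₂ (inj₂ (inj₂ w))
  to∘two-two∷₋₂ (suc (suc k)) w = refl
  from : MarkedComposition (1 + m) ⊎ (MarkedComposition m ⊎ (Composition m ⊎ Composition₋₂ m)) →
         MarkedComposition (2 + m)
  from         (inj₁ x)               = one∷ x
  from         (inj₂ (inj₁ x))        = two∷ x
  from         (inj₂ (inj₂ (inj₁ w))) = one-one∷ w
  from {m = m} (inj₂ (inj₂ (inj₂ w))) = two-two∷₋₂ m w
  to∘from : ∀ {m} y → to (from y) ≡ y
  to∘from     (inj₁ x)               = refl
  to∘from     (inj₂ (inj₁ x))        = refl
  to∘from     (inj₂ (inj₂ (inj₁ w))) = refl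
  to∘from {m} (inj₂ (inj₂ (inj₂ w))) = to∘two-two∷₋₂ m w
  from∘to : ∀ {m} (x : MarkedComposition (2 + m)) → from (to x) ≡ x
  from∘to (one∷ x)     = refl
  from∘to (two∷ x)     = refl
  from∘to (one-one∷ w) = refl
  from∘to (two-two∷ w) = refl

markedCount-rec : ∀ n →
  (suc n) * fib (suc n) ≡ n * fib n + ((n ∸ 1) * fib (n ∸ 1) + (fib (suc n) + fib (n ∸ 1)))
markedCount-rec 0 = refl
markedCount-rec 1 = refl
markedCount-rec (suc (suc m)) = identity m (fib (suc (suc m))) (fib (suc m))
  where
  open +-*-Solver
  identity : ∀ m a b →
    (3 + m) * (a + b) ≡ (2 + m) * a + ((1 + m) * b + ((a + b) + b))
  identity = solve 3 (λ m a b → (con 3 :+ m) :* (a :+ b)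
                      := (con 2 :+ m) :* a :+ ((con 1 :+ m) :* b :+ ((a :+ b) :+ b))) refl

markedComposition↔Fin : ∀ n → MarkedComposition n ↔ Fin ((n ∸ 1) * fib (n ∸ 1))
markedComposition↔Fin 0 = mk↔ₛ′ (λ ()) (λ ()) (λ ()) (λ ())
markedComposition↔Fin 1 = mk↔ₛ′ (λ { (one∷ ()) }) (λ ()) (λ ()) (λ { (one∷ ()) })
markedComposition↔Fin (suc (suc n)) =
  subst (λ k → MarkedComposition (2 + n) ↔ Fin k) (sym (markedCount-rec n))
    (↔-trans markedComposition-unfold
      (markedComposition↔Fin (suc n) ⊎-↔-+ markedComposition↔Fin n
        ⊎-↔-+ composition↔Fin n ⊎-↔-+ composition₋₂↔Fin n))

total : List Part → ℕ
total rs = sum (map val rs)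

toList : Composition n → List Part
toList []       = []
toList (one∷ w) = one ∷ toList w
toList (two∷ w) = two ∷ toList w

toList-total : (w : Composition n) → total (toList w) ≡ n
toList-total []       = refl
toList-total (one∷ w) = cong suc (toList-total w)
toList-total (two∷ w) = cong (2 +_) (toList-total w)

toList-injective : {v w : Composition n} → toList v ≡ toList w → v ≡ w
toList-injective {v = []}     {[]}     _  = refl
toList-injective {v = one∷ v} {one∷ w} eq = cong one∷_ (toList-injective (∷-injectiveʳ eq))
toList-injective {v = two∷ v} {two∷ w} eq = cong two∷_ (toList-injective (∷-injectiveʳ eq))
toList-injective {v = one∷ _} {two∷ _} ()
toList-injective {v = two∷ _} {one∷ _} ()

fromList : (rs : List Part) → Composition (total rs)
fromList []         = []
fromList (one ∷ rs) = one∷ fromList rs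
fromList (two ∷ rs) = two∷ fromList rs

toList-fromList : ∀ rs → toList (fromList rs) ≡ rs
toList-fromList []         = refl
toList-fromList (one ∷ rs) = cong (one ∷_) (toList-fromList rs)
toList-fromList (two ∷ rs) = cong (two ∷_) (toList-fromList rs)

_≟-Part_ : DecidableEquality Part
one ≟-Part one = yes refl
one ≟-Part two = no λ ()
two ≟-Part one = no λ ()
two ≟-Part two = yes refl

IsLevel-irrelevant : ∀ rs j (l l′ : IsLevel rs j) → l ≡ l′
IsLevel-irrelevant _ _ (a , b , c) (a′ , b′ , c′) =
  cong₂ _,_ (≤-irrelevant a a′) (cong₂ _,_ (≤-irrelevant b b′) (≡-irrelevant-Maybe c c′))
  where
  ≡-irrelevant-Maybe : UIP (Maybe Part)
  ≡-irrelevant-Maybe = Decidable⇒UIP.≡-irrelevant (Maybe.≡-dec _≟-Part_)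

IsLevel⇒nonempty : ∀ rs → IsLevel rs j → 1 ≤ length rs
IsLevel⇒nonempty _ (1≤j , j<k , _) = ≤-trans 1≤j (<⇒≤ j<k)

IsLevel-∷ : ∀ p rs → IsLevel rs j → IsLevel (p ∷ rs) (suc j)
IsLevel-∷ {j = suc j} p _ (_ , j<k , eq) = s≤s z≤n , s≤s j<k , eq

IsLevel-tail : ∀ p rs → IsLevel (p ∷ rs) (2 + j) → IsLevel rs (suc j)
IsLevel-tail p _ (_ , s≤s j<k , eq) = s≤s z≤n , j<k , eq

Marked-≡ : (x y : Marked n) → parts x ≡ parts y → mark x ≡ mark y → x ≡ y
Marked-≡ (marked rs ne s j l) (marked .rs ne′ s′ .j l′) refl refl
  with refl ← ≤-irrelevant ne ne′ | refl ← ≡-irrelevant s s′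
     | refl ← IsLevel-irrelevant rs j l l′ = refl

parts′ : MarkedComposition n → List Part
parts′ (one∷ x)     = one ∷ parts′ x
parts′ (two∷ x)     = two ∷ parts′ x
parts′ (one-one∷ w) = one ∷ one ∷ toList w
parts′ (two-two∷ w) = two ∷ two ∷ toList w

mark′ : MarkedComposition n → ℕ
mark′ (one∷ x)     = suc (mark′ x)
mark′ (two∷ x)     = suc (mark′ x)
mark′ (one-one∷ _) = 1
mark′ (two-two∷ _) = 1

parts′-total : (x : MarkedComposition n) → total (parts′ x) ≡ n
parts′-total (one∷ x)     = cong suc (parts′-total x)
parts′-total (two∷ x)     = cong (2 +_) (parts′-total x)
parts′-total (one-one∷ w) = cong (2 +_) (toList-total w)
parts′-total (two-two∷ w) = cong (4 +_) (toList-total w)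

mark′-isLevel : (x : MarkedComposition n) → IsLevel (parts′ x) (mark′ x)
mark′-isLevel (one∷ x)     = IsLevel-∷ one (parts′ x) (mark′-isLevel x)
mark′-isLevel (two∷ x)     = IsLevel-∷ two (parts′ x) (mark′-isLevel x)
mark′-isLevel (one-one∷ _) = s≤s z≤n , s≤s (s≤s z≤n) , refl
mark′-isLevel (two-two∷ _) = s≤s z≤n , s≤s (s≤s z≤n) , refl

toMarked : MarkedComposition n → Marked n
toMarked x = marked (parts′ x) (IsLevel⇒nonempty (parts′ x) (mark′-isLevel x)) (parts′-total x)
                    (mark′ x) (mark′-isLevel x)

mark′≢0 : (x : MarkedComposition n) → mark′ x ≢ 0
mark′≢0 (one∷ _)     ()
mark′≢0 (two∷ _)     ()
mark′≢0 (one-one∷ _) ()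
mark′≢0 (two-two∷ _) ()

parts′-mark′-injective : (x y : MarkedComposition n) →
  parts′ x ≡ parts′ y → mark′ x ≡ mark′ y → x ≡ y
parts′-mark′-injective (one∷ x) (one∷ y) ps ms =
  cong one∷_ (parts′-mark′-injective x y (∷-injectiveʳ ps) (suc-injective ms))
parts′-mark′-injective (two∷ x) (two∷ y) ps ms =
  cong two∷_ (parts′-mark′-injective x y (∷-injectiveʳ ps) (suc-injective ms))
parts′-mark′-injective (one-one∷ v) (one-one∷ w) ps _ =
  cong one-one∷_ (toList-injective (∷-injectiveʳ (∷-injectiveʳ ps)))
parts′-mark′-injective (two-two∷ v) (two-two∷ w) ps _ =
  cong two-two∷_ (toList-injective (∷-injectiveʳ (∷-injectiveʳ ps)))
parts′-mark′-injective (one∷ x) (one-one∷ _) _ ms = ⊥-elim (mark′≢0 x (suc-injective ms))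
parts′-mark′-injective (two∷ x) (two-two∷ _) _ ms = ⊥-elim (mark′≢0 x (suc-injective ms))
parts′-mark′-injective (one-one∷ _) (one∷ y) _ ms = ⊥-elim (mark′≢0 y (suc-injective (sym ms)))
parts′-mark′-injective (two-two∷ _) (two∷ y) _ ms = ⊥-elim (mark′≢0 y (suc-injective (sym ms)))
parts′-mark′-injective (one∷ _)     (two∷ _)     () _
parts′-mark′-injective (one∷ _)     (two-two∷ _) () _
parts′-mark′-injective (two∷ _)     (one∷ _)     () _
parts′-mark′-injective (two∷ _)     (one-one∷ _) () _
parts′-mark′-injective (one-one∷ _) (two∷ _)     () _
parts′-mark′-injective (one-one∷ _) (two-two∷ _) () _
parts′-mark′-injective (two-two∷ _) (one∷ _)     () _
parts′-mark′-injective (two-two∷ _) (one-one∷ _) () _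

decode : ∀ rs j → IsLevel rs j →
  Σ (MarkedComposition (total rs)) λ x → parts′ x ≡ rs × mark′ x ≡ j
decode rs         0 (() , _)
decode []         (suc j) (_ , () , _)
decode (_ ∷ [])   1 (_ , s≤s () , _)
decode (one ∷ one ∷ rs) 1 _ =
  one-one∷ fromList rs , cong (λ l → one ∷ one ∷ l) (toList-fromList rs) , refl
decode (two ∷ two ∷ rs) 1 _ =
  two-two∷ fromList rs , cong (λ l → two ∷ two ∷ l) (toList-fromList rs) , refl
decode (one ∷ two ∷ _)  1 (_ , _ , ())
decode (two ∷ one ∷ _)  1 (_ , _ , ())
decode (one ∷ rs) (suc (suc j)) l with decode rs (suc j) (IsLevel-tail one rs l)
... | x , ps , ms = one∷ x , cong (one ∷_) ps , cong suc ms
decode (two ∷ rs) (suc (suc j)) l with decode rs (suc j) (IsLevel-tail two rs l)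
... | x , ps , ms = two∷ x , cong (two ∷_) ps , cong suc ms

markedComposition↔Marked : MarkedComposition n ↔ Marked n
markedComposition↔Marked = ⤖⇒↔ (mk⤖ (injective , strictlySurjective⇒surjective surjective))
  where
  injective : {x y : MarkedComposition n} → toMarked x ≡ toMarked y → x ≡ y
  injective {x = x} {y} eq = parts′-mark′-injective x y (cong parts eq) (cong mark eq)
  surjective : (y : Marked n) → ∃ λ x → toMarked x ≡ y
  surjective y@(marked rs _ refl j l) with decode rs j l
  ... | x , ps , ms = x , Marked-≡ (toMarked x) y ps ms

marked↔Fin : ∀ n → Marked n ↔ Fin ((n ∸ 1) * fib (n ∸ 1))
marked↔Fin n = ↔-trans (↔-sym markedComposition↔Marked) (markedComposition↔Fin n)

entry-length : (xs : List A) → 1 ≤ length xs → ∃ λ x → entry xs (length xs) ≡ just x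
entry-length (x ∷ [])     _ = x , refl
entry-length (_ ∷ y ∷ ys) _ = entry-length (y ∷ ys) (s≤s z≤n)

markedAtEnd⇒entry≡last : ∀ {p} (x : Marked n) → suc (mark x) ≡ length (parts x) →
  entry (parts x) (length (parts x)) ≡ just p → entry (parts x) (mark x) ≡ just p
markedAtEnd⇒entry≡last x atEnd last =
  trans (proj₂ (proj₂ (isLevel x))) (trans (cong (entry (parts x)) atEnd) last)

classify : (x : Marked n) → A′ x ⊎ B′ x ⊎ C′ x ⊎ D′ x
classify x with entry-length (parts x) (nonempty x) | suc (mark x) ≟ length (parts x)
... | one , last | no notEnd = inj₁ (last , notEnd)
... | two , last | no notEnd = inj₂ (inj₁ (last , notEnd))
... | one , last | yes atEnd = inj₂ (inj₂ (inj₁ (atEnd , markedAtEnd⇒entry≡last x atEnd last , last)))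
... | two , last | yes atEnd = inj₂ (inj₂ (inj₂ (atEnd , markedAtEnd⇒entry≡last x atEnd last , last)))

one≢two : {e : Maybe Part} → e ≡ just one → e ≡ just two → ⊥
one≢two refl ()

mainTheorem15 : ((n : ℕ) → 1 ≤ n → Marked n ↔ Fin ((n ∸ 1) * fib (n ∸ 1)))
    × ((n : ℕ) → 3 ≤ n →
        ((x : Marked n) → A′ x ⊎ B′ x ⊎ C′ x ⊎ D′ x)
        × Disjoint {n} A′ B′ × Disjoint {n} A′ C′ × Disjoint {n} A′ D′
        × Disjoint {n} B′ C′ × Disjoint {n} B′ D′ × Disjoint {n} C′ D′)
mainTheorem15 = (λ n _ → marked↔Fin n) , λ n _ →
  classify
  , (λ _ a b → one≢two (proj₁ a) (proj₁ b))
  , (λ _ a c → proj₂ a (proj₁ c))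
  , (λ _ a d → proj₂ a (proj₁ d))
  , (λ _ b c → proj₂ b (proj₁ c))
  , (λ _ b d → proj₂ b (proj₁ d))
  , (λ _ c d → one≢two (proj₂ (proj₂ c)) (proj₂ (proj₂ d)))
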